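{- For $n\ge 2$: (i) $\theta_1^{(n)}=\mathrm{C}_{n-1}$; (ii) $\theta_{n-1}^{(n)}=n-1$; (iii) if $n>2$, then $\theta_k^{(n)}=\theta_{k-1}^{(n-1)}+\theta_{k+1}^{(n)}$ for every $k\in[2,n-2]$.
   Context: $\mathrm{C}_m=\frac{1}{m+1}\binom{2m}{m}$ is the $m$-th Catalan number. For $n\ge1$, a non-degenerate indexing matrix (for $n$) is a $2\times m$ matrix $A=[a_{ij}]$ with $1\le m\le n$ such that: $a_{ij}\in[0,n-1]$; $a_{1j}<a_{1k}$ for $j<k$; $a_{2j}\le a_{2k}$ for $j<k$; if $a_{2j}=a_{2k}$ with $j<k$ then $a_{2j}=a_{2k}=0$; $a_{1j}\ge a_{2j}$ for all $j$. It is positive if all its entries are positive. For $n\ge2$ and $k\in[1,n-1]$, $\theta_k^{(n)}$ is the number of positive non-degenerate indexing matrices $C=[c_{ij}]$ for $n$ with $c_{11}=k$; also $\theta_1^{(1)}:=1$. -}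

module Defs where

open import Data.Nat using (ℕ; zero; suc; _+_; _*_; _∸_; _≤_; _<_; _≥_; _≤?_; _<?_; _≟_)
open import Data.Nat.DivMod using (_/_)
open import Data.Nat.Combinatorics using (_C_)
open import Data.Product using (_×_; _,_; proj₁; proj₂)
open import Data.Product.Relation.Unary.All using () 
open import Data.Sum using (_⊎_)
open import Data.List using (List; []; _∷_; length; map; concatMap; upTo; filter; cartesianProduct)
open import Data.List.Relation.Unary.All using (All; all?)
open import Data.List.Relation.Unary.AllPairs using (AllPairs; allPairs?)
open import Relation.Nullary using (Dec; ¬_)
open import Relation.Nullary.Decidable using (_×-dec_; _→-dec_)
open import Relation.Binary.PropositionalEquality using (_≡_)

catalan : ℕ → ℕ
catalan m = ((2 * m) C m) / suc m

-- A 2 × m matrix is represented as the list of its m columns (a₁ⱼ , a₂ⱼ),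
-- column j at position j of the list.
Column : Set
Column = ℕ × ℕ

Matrix : Set
Matrix = List Column

PairCond : Column → Column → Set
PairCond (a1j , a2j) (a1k , a2k) =
  (a1j < a1k) × (a2j ≤ a2k) × (a2j ≡ a2k → (a2j ≡ 0 × a2k ≡ 0))

ColCond : ℕ → Column → Set
ColCond n (a1 , a2) = (a1 < n) × (a2 < n) × (a2 ≤ a1)

NonDegIndexing : ℕ → Matrix → Set
NonDegIndexing n A =
  (1 ≤ length A) × (length A ≤ n) × All (ColCond n) A × AllPairs PairCond A

Positive : Matrix → Set
Positive A = All (λ c → (0 < proj₁ c) × (0 < proj₂ c)) A

FirstEntryIs : ℕ → Matrix → Set
FirstEntryIs k []            = ¬ (k ≡ k)   -- empty matrix never qualifies
FirstEntryIs k ((c , _) ∷ _) = c ≡ k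

Counted : ℕ → ℕ → Matrix → Set
Counted n k A = NonDegIndexing n A × Positive A × FirstEntryIs k A

pairCond? : ∀ c d → Dec (PairCond c d)
pairCond? (a , b) (c , d) = (a <? c) ×-dec ((b ≤? d) ×-dec ((b ≟ d) →-dec ((b ≟ 0) ×-dec (d ≟ 0))))

colCond? : ∀ n c → Dec (ColCond n c)
colCond? n (a , b) = (a <? n) ×-dec ((b <? n) ×-dec (b ≤? a))

firstEntryIs? : ∀ k A → Dec (FirstEntryIs k A)
firstEntryIs? k [] = (k ≟ k) →-dec Relation.Nullary.no (λ ())
  where import Relation.Nullary
firstEntryIs? k ((c , _) ∷ _) = c ≟ k

counted? : ∀ n k A → Dec (Counted n k A)
counted? n k A =
  ((1 ≤? length A) ×-dec ((length A ≤? n) ×-dec (all? (colCond? n) A ×-dec allPairs? pairCond? A)))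
  ×-dec (all? (λ c → (0 <? proj₁ c) ×-dec (0 <? proj₂ c)) A ×-dec firstEntryIs? k A)

entries : ℕ → List Column
entries n = cartesianProduct (upTo n) (upTo n)

matricesOfLength : ℕ → ℕ → List Matrix
matricesOfLength n zero    = [] ∷ []
matricesOfLength n (suc m) = concatMap (λ c → map (c ∷_) (matricesOfLength n m)) (entries n)

candidates : ℕ → List Matrix
candidates n = concatMap (λ m → matricesOfLength n (suc m)) (upTo n)

θ : ℕ → ℕ → ℕ
θ n k = length (filter (counted? n k) (candidates n))

module Submission where

-- Positivity makes the weak condition on the second row strict, so a matrix counted by θ n k
-- is a chain of cells (x , y), 1 ≤ y ≤ x < n, strictly increasing in both coordinates and
-- starting in column k. The number of chains starting at (x , y) depends only on r = n − 1 − x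
-- and d = x − y: splitting off the second cell, first by its column and then by its row, shows
-- that it is the ballot number defined by ballot 0 d = 1 and ballot (r + 1) d = Σ_{j < d + 2} ballot r j.
-- Hence θ n k = Σ_{j < k} ballot (n − 1 − k) j, which gives (ii) and (iii) at once, while (i)
-- follows from Σ_{j < d} ballot r j = C(N, r + 1) − C(N, r) with N = d + 2r + 1 and the
-- absorption identity for binomial coefficients.

open import Level using (Level)
open import Algebra.Properties.CommutativeSemigroup using (interchange)
open import Data.Bool.Base using (true; false; if_then_else_)
open import Data.List.Base
  using (List; []; _∷_; _++_; map; concatMap; applyUpTo; upTo; cartesianProduct; filter; length)
open import Data.List.Relation.Unary.All as All using (All; []; _∷_)
open import Data.List.Relation.Unary.AllPairs as AllPairs using ()
open import Data.List.Relation.Unary.Linked as Linked using (Linked; [-]; _∷_; linked?)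
open import Data.List.Relation.Unary.Linked.Properties using (AllPairs⇒Linked; Linked⇒AllPairs)
open import Data.Nat.Base
open import Data.Nat.Combinatorics
  using (_C_; nC1≡n; nCk≡nC[n∸k]; k>n⇒nCk≡0; nCk+nC[k+1]≡[n+1]C[k+1])
open import Data.Nat.DivMod using (_/_; m*n/n≡m)
open import Data.Nat.Properties
open import Data.Nat.Tactic.RingSolver using (solve-∀)
open import Data.Product.Base using (_×_; _,_; proj₁; proj₂)
open import Function.Base using (id)
open import Function.Bundles using (_⇔_; Equivalence; mk⇔)
open import Relation.Binary.PropositionalEquality
open import Relation.Nullary.Decidable using (Dec; yes; no; does; _×-dec_)
open import Relation.Nullary.Negation using (¬_; contradiction)
open import Relation.Unary using (Pred; Decidable)

open import Defs

private variable
  a b p q : Level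
  A : Set a
  B : Set b
  P : Set p
  Q : Set q

-- Indicators and finite sums

𝟙 : Dec P → ℕ
𝟙 P? = if does P? then 1 else 0

𝟙-yes : (P? : Dec P) → P → 𝟙 P? ≡ 1
𝟙-yes (yes _) _ = refl
𝟙-yes (no ¬p) p = contradiction p ¬p

𝟙-no : (P? : Dec P) → ¬ P → 𝟙 P? ≡ 0
𝟙-no (yes p) ¬p = contradiction p ¬p
𝟙-no (no _)  _  = refl

𝟙-× : (P? : Dec P) (Q? : Dec Q) → 𝟙 (P? ×-dec Q?) ≡ 𝟙 P? * 𝟙 Q?
𝟙-× (yes _) Q? = sym (+-identityʳ (𝟙 Q?))
𝟙-× (no _)  Q? = refl

𝟙-⇔ : P ⇔ Q → (P? : Dec P) (Q? : Dec Q) → 𝟙 P? ≡ 𝟙 Q?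
𝟙-⇔ P⇔Q (yes p) Q? = sym (𝟙-yes Q? (Equivalence.to P⇔Q p))
𝟙-⇔ P⇔Q (no ¬p) Q? = sym (𝟙-no Q? (λ q → ¬p (Equivalence.from P⇔Q q)))

𝟙-*-cong : ∀ {z w} (P? : Dec P) → (P → z ≡ w) → 𝟙 P? * z ≡ 𝟙 P? * w
𝟙-*-cong (yes p) z≡w = cong (_+ 0) (z≡w p)
𝟙-*-cong (no _)  z≡w = refl

-- By computation: does (m <? n) reduces to the builtin m <ᵇ n.
𝟙-<-split : ∀ a i → 𝟙 (a <? i) ≡ 𝟙 (i ≟ suc a) + 𝟙 (suc a <? i)
𝟙-<-split zero    zero          = refl
𝟙-<-split zero    (suc zero)    = refl
𝟙-<-split zero    (suc (suc i)) = refl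
𝟙-<-split (suc a) zero          = refl
𝟙-<-split (suc a) (suc i)       = 𝟙-<-split a i

∑ : ℕ → (ℕ → ℕ) → ℕ
∑ zero    f = 0
∑ (suc n) f = f 0 + ∑ n (λ i → f (suc i))

∑-cong : ∀ n {f g : ℕ → ℕ} → (∀ i → i < n → f i ≡ g i) → ∑ n f ≡ ∑ n g
∑-cong zero    f≡g = refl
∑-cong (suc n) f≡g = cong₂ _+_ (f≡g 0 z<s) (∑-cong n (λ i i<n → f≡g (suc i) (s<s i<n)))

∑-zero : ∀ n {f : ℕ → ℕ} → (∀ i → i < n → f i ≡ 0) → ∑ n f ≡ 0
∑-zero zero    f≡0 = refl
∑-zero (suc n) f≡0 = cong₂ _+_ (f≡0 0 z<s) (∑-zero n (λ i i<n → f≡0 (suc i) (s<s i<n)))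

∑-const-1 : ∀ n → ∑ n (λ _ → 1) ≡ n
∑-const-1 zero    = refl
∑-const-1 (suc n) = cong suc (∑-const-1 n)

∑-snoc : ∀ n f → ∑ (suc n) f ≡ ∑ n f + f n
∑-snoc zero    f = +-comm (f 0) 0
∑-snoc (suc n) f = trans (cong (f 0 +_) (∑-snoc n (λ i → f (suc i)))) (sym (+-assoc (f 0) _ _))

∑-+ : ∀ n f g → ∑ n (λ i → f i + g i) ≡ ∑ n f + ∑ n g
∑-+ zero    f g = refl
∑-+ (suc n) f g = trans (cong (f 0 + g 0 +_) (∑-+ n (λ i → f (suc i)) (λ i → g (suc i))))
                        (interchange +-commutativeSemigroup (f 0) (g 0) _ _)

∑-*ˡ : ∀ n c f → ∑ n (λ i → c * f i) ≡ c * ∑ n f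
∑-*ˡ zero    c f = sym (*-zeroʳ c)
∑-*ˡ (suc n) c f =
  trans (cong (c * f 0 +_) (∑-*ˡ n c (λ i → f (suc i)))) (sym (*-distribˡ-+ c (f 0) _))

∑-comm : ∀ m n (f : ℕ → ℕ → ℕ) →
  ∑ m (λ i → ∑ n (f i)) ≡ ∑ n (λ j → ∑ m (λ i → f i j))
∑-comm zero    n f = sym (∑-zero n (λ _ _ → refl))
∑-comm (suc m) n f = trans (cong (∑ n (f 0) +_) (∑-comm m n (λ i → f (suc i))))
                           (sym (∑-+ n (f 0) (λ j → ∑ m (λ i → f (suc i) j))))

∑-comm₃ : ∀ a b c (f : ℕ → ℕ → ℕ → ℕ) →
  ∑ a (λ i → ∑ b (λ j → ∑ c (f i j))) ≡ ∑ b (λ j → ∑ c (λ k → ∑ a (λ i → f i j k)))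
∑-comm₃ a b c f =
  trans (∑-comm a b (λ i j → ∑ c (f i j))) (∑-cong b (λ j _ → ∑-comm a c (λ i → f i j)))

∑-δ : ∀ {a n} (f : ℕ → ℕ) → a < n → ∑ n (λ i → 𝟙 (i ≟ a) * f i) ≡ f a
∑-δ {zero}  {suc n} f _ =
  trans (cong₂ _+_ (+-identityʳ (f 0)) (∑-zero n (λ _ _ → refl))) (+-identityʳ (f 0))
∑-δ {suc a} {suc n} f (s<s a<n) = ∑-δ (λ i → f (suc i)) a<n

∑-above : ∀ {a n} (f : ℕ → ℕ) → suc a < n →
  ∑ n (λ i → 𝟙 (a <? i) * f i) ≡ f (suc a) + ∑ n (λ i → 𝟙 (suc a <? i) * f i)
∑-above {a} {n} f sa<n = begin
  ∑ n (λ i → 𝟙 (a <? i) * f i)   ≡⟨ ∑-cong n (λ i _ → split i) ⟩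
  ∑ n (λ i → at i + beyond i)    ≡⟨ ∑-+ n at beyond ⟩
  ∑ n at + ∑ n beyond            ≡⟨ cong (_+ ∑ n beyond) (∑-δ f sa<n) ⟩
  f (suc a) + ∑ n beyond         ∎
  where
  open ≡-Reasoning
  at beyond : ℕ → ℕ
  at     i = 𝟙 (i ≟ suc a) * f i
  beyond i = 𝟙 (suc a <? i) * f i
  split : ∀ i → 𝟙 (a <? i) * f i ≡ at i + beyond i
  split i = trans (cong (_* f i) (𝟙-<-split a i)) (*-distribʳ-+ (f i) (𝟙 (i ≟ suc a)) _)

∑-above-empty : ∀ {a n} (f : ℕ → ℕ) → n ≤ suc a → ∑ n (λ i → 𝟙 (a <? i) * f i) ≡ 0
∑-above-empty {a} {n} f n≤1+a = ∑-zero n (λ i i<n →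
  cong (_* f i) (𝟙-no (a <? i) (λ a<i → <⇒≱ i<n (≤-trans n≤1+a a<i))))

∑ₗ : (A → ℕ) → List A → ℕ
∑ₗ f []       = 0
∑ₗ f (x ∷ xs) = f x + ∑ₗ f xs

∑ₗ-cong : ∀ {f g : A → ℕ} → (∀ x → f x ≡ g x) → ∀ xs → ∑ₗ f xs ≡ ∑ₗ g xs
∑ₗ-cong f≡g []       = refl
∑ₗ-cong f≡g (x ∷ xs) = cong₂ _+_ (f≡g x) (∑ₗ-cong f≡g xs)

∑ₗ-++ : ∀ (f : A → ℕ) xs ys → ∑ₗ f (xs ++ ys) ≡ ∑ₗ f xs + ∑ₗ f ys
∑ₗ-++ f []       ys = refl
∑ₗ-++ f (x ∷ xs) ys = trans (cong (f x +_) (∑ₗ-++ f xs ys)) (sym (+-assoc (f x) _ _))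

∑ₗ-map : ∀ (f : B → ℕ) (g : A → B) xs → ∑ₗ f (map g xs) ≡ ∑ₗ (λ x → f (g x)) xs
∑ₗ-map f g []       = refl
∑ₗ-map f g (x ∷ xs) = cong (f (g x) +_) (∑ₗ-map f g xs)

∑ₗ-concatMap : ∀ (f : B → ℕ) (g : A → List B) xs →
  ∑ₗ f (concatMap g xs) ≡ ∑ₗ (λ x → ∑ₗ f (g x)) xs
∑ₗ-concatMap f g []       = refl
∑ₗ-concatMap f g (x ∷ xs) =
  trans (∑ₗ-++ f (g x) (concatMap g xs)) (cong (∑ₗ f (g x) +_) (∑ₗ-concatMap f g xs))

∑ₗ-*ˡ : ∀ c (f : A → ℕ) xs → ∑ₗ (λ x → c * f x) xs ≡ c * ∑ₗ f xs
∑ₗ-*ˡ c f []       = sym (*-zeroʳ c)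
∑ₗ-*ˡ c f (x ∷ xs) = trans (cong (c * f x +_) (∑ₗ-*ˡ c f xs)) (sym (*-distribˡ-+ c (f x) _))

∑ₗ-applyUpTo : ∀ (f : A → ℕ) (g : ℕ → A) n → ∑ₗ f (applyUpTo g n) ≡ ∑ n (λ i → f (g i))
∑ₗ-applyUpTo f g zero    = refl
∑ₗ-applyUpTo f g (suc n) = cong (f (g 0) +_) (∑ₗ-applyUpTo f (λ i → g (suc i)) n)

∑ₗ-cartesianProduct : ∀ (f : A × B → ℕ) xs ys →
  ∑ₗ f (cartesianProduct xs ys) ≡ ∑ₗ (λ x → ∑ₗ (λ y → f (x , y)) ys) xs
∑ₗ-cartesianProduct f []       ys = refl
∑ₗ-cartesianProduct f (x ∷ xs) ys = trans (∑ₗ-++ f (map (x ,_) ys) _)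
  (cong₂ _+_ (∑ₗ-map f (x ,_) ys) (∑ₗ-cartesianProduct f xs ys))

length-filter : ∀ {P : Pred A p} (P? : Decidable P) xs →
  length (filter P? xs) ≡ ∑ₗ (λ x → 𝟙 (P? x)) xs
length-filter P? []       = refl
length-filter P? (x ∷ xs) with does (P? x)
... | true  = cong suc (length-filter P? xs)
... | false = length-filter P? xs

-- Binomial coefficients, ballot numbers and Catalan numbers

C-pascal : ∀ n k → suc n C suc k ≡ n C k + n C suc k
C-pascal n k = sym (nCk+nC[k+1]≡[n+1]C[k+1] n k)

C-sym : ∀ {n} k j → k + j ≡ n → n C k ≡ n C j
C-sym k j refl = trans (nCk≡nC[n∸k] (m≤m+n k j)) (cong ((k + j) C_) (m+n∸m≡n k j))

C-absorb : ∀ {n} k j → k + j ≡ n → (n C k) * j ≡ (n C suc k) * suc k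
C-absorb zero    j    refl =
  trans (*-identityˡ j) (trans (sym (nC1≡n j)) (sym (*-identityʳ (j C 1))))
C-absorb (suc k) zero refl = trans (*-zeroʳ ((suc k + 0) C suc k))
  (sym (cong (_* suc (suc k)) (k>n⇒nCk≡0 (s≤s (s≤s (≤-reflexive (+-identityʳ k)))))))
C-absorb {suc n} (suc k) (suc j) 2+k+j≡1+n = begin
  (suc n C suc k) * suc j              ≡⟨ cong (_* suc j) (C-pascal n k) ⟩
  (c₀ + c₁) * suc j                    ≡⟨ *-distribʳ-+ (suc j) c₀ c₁ ⟩
  c₀ * suc j + c₁ * suc j              ≡⟨ cong (_+ c₁ * suc j) (C-absorb k (suc j) k+1+j≡n) ⟩
  c₁ * suc k + c₁ * suc j              ≡⟨ shift c₁ k j ⟩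
  c₁ * suc (suc k) + c₁ * j            ≡⟨ cong (c₁ * suc (suc k) +_) (C-absorb (suc k) j 1+k+j≡n) ⟩
  c₁ * suc (suc k) + c₂ * suc (suc k)  ≡⟨ *-distribʳ-+ (suc (suc k)) c₁ c₂ ⟨
  (c₁ + c₂) * suc (suc k)              ≡⟨ cong (_* suc (suc k)) (C-pascal n (suc k)) ⟨
  (suc n C suc (suc k)) * suc (suc k)  ∎
  where
  open ≡-Reasoning
  c₀ c₁ c₂ : ℕ
  c₀ = n C k
  c₁ = n C suc k
  c₂ = n C suc (suc k)
  k+1+j≡n : k + suc j ≡ n
  k+1+j≡n = suc-injective 2+k+j≡1+n
  1+k+j≡n : suc k + j ≡ n
  1+k+j≡n = trans (sym (+-suc k j)) k+1+j≡n
  shift : ∀ b k j → b * suc k + b * suc j ≡ b * suc (suc k) + b * j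
  shift = solve-∀

ballot : ℕ → ℕ → ℕ
ballot zero    d = 1
ballot (suc r) d = ∑ (2 + d) (ballot r)

∑-ballot : ∀ r d → ∑ d (ballot r) + (d + suc (r + r)) C r ≡ (d + suc (r + r)) C suc r
∑-ballot r       zero    = sym (C-sym (suc r) r refl)
∑-ballot zero    (suc d) = begin
  ∑ (suc d) (λ _ → 1) + 1  ≡⟨ cong (_+ 1) (∑-const-1 (suc d)) ⟩
  suc d + 1                ≡⟨ nC1≡n (suc d + 1) ⟨
  (suc d + 1) C 1          ∎
  where open ≡-Reasoning
∑-ballot (suc r) (suc d) = begin
  ∑ (suc d) (ballot (suc r)) + suc N C suc r  ≡⟨ cong₂ _+_ (∑-snoc d (ballot (suc r))) (C-pascal N r) ⟩
  (earlier + last) + (N C r + N C suc r)      ≡⟨ regroup earlier last (N C r) (N C suc r) ⟩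
  (last + N C r) + (earlier + N C suc r)      ≡⟨ cong₂ _+_ lastColumn (∑-ballot (suc r) d) ⟩
  N C suc r + N C suc (suc r)                 ≡⟨ C-pascal N (suc r) ⟨
  suc N C suc (suc r)                         ∎
  where
  open ≡-Reasoning
  N earlier last : ℕ
  N       = d + suc (suc (r + suc r))
  earlier = ∑ d (ballot (suc r))
  last    = ballot (suc r) d
  regroup : ∀ s b x y → (s + b) + (x + y) ≡ (b + x) + (s + y)
  regroup = solve-∀
  width : ∀ d r → suc (suc d) + suc (r + r) ≡ d + suc (suc (r + suc r))
  width = solve-∀
  lastColumn : last + N C r ≡ N C suc r
  lastColumn = subst (λ w → last + w C r ≡ w C suc r) (width d r) (∑-ballot r (suc (suc d)))

ballot-catalan : ∀ r → ballot r 0 ≡ catalan (suc r)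
ballot-catalan zero    = refl
ballot-catalan (suc r) = sym (begin
  ((2 * (2 + r)) C (2 + r)) / (3 + r)  ≡⟨ cong (λ m → (m C (2 + r)) / (3 + r)) (doubled r) ⟩
  (suc N C (2 + r)) / (3 + r)          ≡⟨ cong (_/ (3 + r)) central ⟩
  (u * (3 + r)) / (3 + r)              ≡⟨ m*n/n≡m u (3 + r) ⟩
  u                                    ∎)
  where
  open ≡-Reasoning
  N u c₀ c₁ : ℕ
  N  = 2 + suc (r + r)
  u  = ballot (suc r) 0
  c₀ = N C r
  c₁ = N C suc r
  doubled : ∀ r → 2 * (2 + r) ≡ 3 + suc (r + r)
  doubled = solve-∀
  split₀ : ∀ r → r + (3 + r) ≡ 2 + suc (r + r)
  split₀ = solve-∀
  split₁ : ∀ r → (2 + r) + (1 + r) ≡ 2 + suc (r + r)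
  split₁ = solve-∀
  expand : ∀ c r → c * (3 + r) ≡ c + c + c * suc r
  expand = solve-∀
  scaled : u * (3 + r) + c₁ * suc r ≡ c₁ + c₁ + c₁ * suc r
  scaled = begin
    u * (3 + r) + c₁ * suc r    ≡⟨ cong (u * (3 + r) +_) (C-absorb r (3 + r) (split₀ r)) ⟨
    u * (3 + r) + c₀ * (3 + r)  ≡⟨ *-distribʳ-+ (3 + r) u c₀ ⟨
    (u + c₀) * (3 + r)          ≡⟨ cong (_* (3 + r)) (∑-ballot r 2) ⟩
    c₁ * (3 + r)                ≡⟨ expand c₁ r ⟩
    c₁ + c₁ + c₁ * suc r        ∎
  central : suc N C (2 + r) ≡ u * (3 + r)
  central = begin
    suc N C (2 + r)   ≡⟨ C-pascal N (suc r) ⟩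
    c₁ + N C (2 + r)  ≡⟨ cong (c₁ +_) (C-sym (2 + r) (1 + r) (split₁ r)) ⟩
    c₁ + c₁           ≡⟨ +-cancelʳ-≡ (c₁ * suc r) _ _ scaled ⟨
    u * (3 + r)       ∎

-- Positive indexing matrices as chains of cells

infix 4 _≺_
_≺_ : Column → Column → Set
(x , y) ≺ (x′ , y′) = x < x′ × y < y′

≺-trans : ∀ {c d e} → c ≺ d → d ≺ e → c ≺ e
≺-trans (x<x′ , y<y′) (x′<x″ , y′<y″) = <-trans x<x′ x′<x″ , <-trans y<y′ y′<y″

Cell : ℕ → Column → Set
Cell n (x , y) = 0 < y × y ≤ x × x < n

Step : ℕ → Column → Column → Set
Step n c d = c ≺ d × Cell n d

Start : ℕ → ℕ → Column → Set
Start n k c = proj₁ c ≡ k × Cell n c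

cell? : ∀ n c → Dec (Cell n c)
cell? n (x , y) = (0 <? y) ×-dec ((y ≤? x) ×-dec (x <? n))

step? : ∀ n c d → Dec (Step n c d)
step? n (x , y) (x′ , y′) = ((x <? x′) ×-dec (y <? y′)) ×-dec cell? n (x′ , y′)

start? : ∀ n k c → Dec (Start n k c)
start? n k c = (proj₁ c ≟ k) ×-dec cell? n c

cell⇒colCond : ∀ {n c} → Cell n c → ColCond n c
cell⇒colCond (_ , y≤x , x<n) = x<n , ≤-<-trans y≤x x<n , y≤x

cell⇒positive : ∀ {n c} → Cell n c → 0 < proj₁ c × 0 < proj₂ c
cell⇒positive (0<y , y≤x , _) = <-≤-trans 0<y y≤x , 0<y

colCond∧positive⇒cell : ∀ {n c} → ColCond n c × (0 < proj₁ c × 0 < proj₂ c) → Cell n c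
colCond∧positive⇒cell ((x<n , _ , y≤x) , _ , 0<y) = 0<y , y≤x , x<n

≺⇒pairCond : ∀ {c d} → c ≺ d → PairCond c d
≺⇒pairCond (x<x′ , y<y′) = x<x′ , <⇒≤ y<y′ , λ y≡y′ → contradiction y≡y′ (<⇒≢ y<y′)

pairCond⇒step : ∀ {n c d} → Cell n c → Cell n d → PairCond c d → Step n c d
pairCond⇒step (0<y , _) d-cell (x<x′ , y≤y′ , equal⇒0) =
  (x<x′ , ≤∧≢⇒< y≤y′ (λ y≡y′ → <⇒≢ 0<y (sym (proj₁ (equal⇒0 y≡y′))))) , d-cell

pairConds⇒steps : ∀ {n c A} →
  All (Cell n) (c ∷ A) → Linked PairCond (c ∷ A) → Linked (Step n) (c ∷ A)
pairConds⇒steps _                           [-]            = [-]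
pairConds⇒steps (c-cell ∷ d-cell ∷ cells) (pair ∷ pairs) =
  pairCond⇒step c-cell d-cell pair ∷ pairConds⇒steps (d-cell ∷ cells) pairs

chain-cells : ∀ {n c A} → Cell n c → Linked (Step n) (c ∷ A) → All (Cell n) (c ∷ A)
chain-cells c-cell [-]                    = c-cell ∷ []
chain-cells c-cell ((_ , d-cell) ∷ steps) = c-cell ∷ chain-cells d-cell steps

chain-length : ∀ {n x y A} → x < n → Linked (Step n) ((x , y) ∷ A) → length A + x < n
chain-length x<n [-] = x<n
chain-length {x = x} {A = _ ∷ A} x<n (((x<x′ , _) , _ , _ , x′<n) ∷ steps) = ≤-<-trans
  (≤-trans (≤-reflexive (sym (+-suc (length A) x))) (+-monoʳ-≤ (length A) x<x′))
  (chain-length x′<n steps)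

counted⇔chain : ∀ n k c A → Counted n k (c ∷ A) ⇔ (Start n k c × Linked (Step n) (c ∷ A))
counted⇔chain n k (x , y) A = mk⇔ to from
  where
  to : Counted n k ((x , y) ∷ A) → Start n k (x , y) × Linked (Step n) ((x , y) ∷ A)
  to ((_ , _ , cols , pairs) , positive , x≡k) =
    (x≡k , All.head cells) , pairConds⇒steps cells (AllPairs⇒Linked pairs)
    where
    cells : All (Cell n) ((x , y) ∷ A)
    cells = All.zipWith colCond∧positive⇒cell (cols , positive)
  from : Start n k (x , y) × Linked (Step n) ((x , y) ∷ A) → Counted n k ((x , y) ∷ A)
  from ((x≡k , c-cell@(_ , _ , x<n)) , steps) =
    ( s≤s z≤n
    , ≤-trans (s≤s (m≤m+n (length A) x)) (chain-length x<n steps)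
    , All.map cell⇒colCond cells
    , AllPairs.map ≺⇒pairCond (Linked⇒AllPairs ≺-trans (Linked.map proj₁ steps)))
    , All.map cell⇒positive cells
    , x≡k
    where
    cells : All (Cell n) ((x , y) ∷ A)
    cells = chain-cells c-cell steps

-- Counting chains

chains : ℕ → ℕ → Column → ℕ
chains n m c = ∑ₗ (λ A → 𝟙 (linked? (step? n) (c ∷ A))) (matricesOfLength n m)

∑ₗ-matricesOfLength : ∀ n m (h : Matrix → ℕ) →
  ∑ₗ h (matricesOfLength n (suc m))
    ≡ ∑ n (λ x → ∑ n (λ y → ∑ₗ (λ A → h ((x , y) ∷ A)) (matricesOfLength n m)))
∑ₗ-matricesOfLength n m h = begin
  ∑ₗ h (concatMap (λ c → map (c ∷_) tails) (entries n))
    ≡⟨ ∑ₗ-concatMap h (λ c → map (c ∷_) tails) (entries n) ⟩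
  ∑ₗ (λ c → ∑ₗ h (map (c ∷_) tails)) (entries n)
    ≡⟨ ∑ₗ-cong (λ c → ∑ₗ-map h (c ∷_) tails) (entries n) ⟩
  ∑ₗ hᶜ (entries n)
    ≡⟨ ∑ₗ-cartesianProduct hᶜ (upTo n) (upTo n) ⟩
  ∑ₗ (λ x → ∑ₗ (λ y → hᶜ (x , y)) (upTo n)) (upTo n)
    ≡⟨ ∑ₗ-cong (λ x → ∑ₗ-applyUpTo (λ y → hᶜ (x , y)) id n) (upTo n) ⟩
  ∑ₗ (λ x → ∑ n (λ y → hᶜ (x , y))) (upTo n)
    ≡⟨ ∑ₗ-applyUpTo (λ x → ∑ n (λ y → hᶜ (x , y))) id n ⟩
  ∑ n (λ x → ∑ n (λ y → hᶜ (x , y))) ∎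
  where
  open ≡-Reasoning
  tails : List Matrix
  tails = matricesOfLength n m
  hᶜ : Column → ℕ
  hᶜ c = ∑ₗ (λ A → h (c ∷ A)) tails

chains-suc : ∀ n m c →
  chains n (suc m) c ≡ ∑ n (λ x → ∑ n (λ y → 𝟙 (step? n c (x , y)) * chains n m (x , y)))
chains-suc n m c = trans (∑ₗ-matricesOfLength n m _) (∑-cong n (λ x _ → ∑-cong n (λ y _ →
  trans (∑ₗ-cong (λ A → 𝟙-× (step? n c (x , y)) (extends (x , y) A)) (matricesOfLength n m))
        (∑ₗ-*ˡ (𝟙 (step? n c (x , y))) (λ A → 𝟙 (extends (x , y) A)) (matricesOfLength n m)))))
  where
  extends : ∀ d A → Dec (Linked (Step n) (d ∷ A))
  extends d A = linked? (step? n) (d ∷ A)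

θ≡∑chains : ∀ n k →
  θ n k ≡ ∑ n (λ m → ∑ n (λ x → ∑ n (λ y → 𝟙 (start? n k (x , y)) * chains n m (x , y))))
θ≡∑chains n k = begin
  length (filter (counted? n k) (candidates n))
    ≡⟨ length-filter (counted? n k) (candidates n) ⟩
  ∑ₗ counted (concatMap (λ m → matricesOfLength n (suc m)) (upTo n))
    ≡⟨ ∑ₗ-concatMap counted (λ m → matricesOfLength n (suc m)) (upTo n) ⟩
  ∑ₗ (λ m → ∑ₗ counted (matricesOfLength n (suc m))) (upTo n)
    ≡⟨ ∑ₗ-applyUpTo (λ m → ∑ₗ counted (matricesOfLength n (suc m))) id n ⟩
  ∑ n (λ m → ∑ₗ counted (matricesOfLength n (suc m)))
    ≡⟨ ∑-cong n (λ m _ → trans (∑ₗ-matricesOfLength n m counted)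
                               (∑-cong n (λ x _ → ∑-cong n (λ y _ → byFirstColumn m x y)))) ⟩
  ∑ n (λ m → ∑ n (λ x → ∑ n (λ y → 𝟙 (start? n k (x , y)) * chains n m (x , y)))) ∎
  where
  open ≡-Reasoning
  counted : Matrix → ℕ
  counted A = 𝟙 (counted? n k A)
  counted≡ : ∀ c A → counted (c ∷ A) ≡ 𝟙 (start? n k c) * 𝟙 (linked? (step? n) (c ∷ A))
  counted≡ c A = trans
    (𝟙-⇔ (counted⇔chain n k c A) (counted? n k (c ∷ A))
         (start? n k c ×-dec linked? (step? n) (c ∷ A)))
    (𝟙-× (start? n k c) (linked? (step? n) (c ∷ A)))
  byFirstColumn : ∀ m x y → ∑ₗ (λ A → counted ((x , y) ∷ A)) (matricesOfLength n m)
                          ≡ 𝟙 (start? n k (x , y)) * chains n m (x , y)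
  byFirstColumn m x y = trans (∑ₗ-cong (counted≡ (x , y)) (matricesOfLength n m))
    (∑ₗ-*ˡ (𝟙 (start? n k (x , y))) (λ A → 𝟙 (linked? (step? n) ((x , y) ∷ A)))
           (matricesOfLength n m))

chains-vanish : ∀ {n} m {x y} → x < n → n ≤ m + x → chains n m (x , y) ≡ 0
chains-vanish zero x<n n≤x = contradiction n≤x (<⇒≱ x<n)
chains-vanish {n} (suc m) {x} {y} x<n n≤m+x =
  trans (chains-suc n m (x , y)) (∑-zero n (λ x′ _ → ∑-zero n (λ y′ _ → vanish x′ y′)))
  where
  vanish : ∀ x′ y′ → 𝟙 (step? n (x , y) (x′ , y′)) * chains n m (x′ , y′) ≡ 0
  vanish x′ y′ = trans
    (𝟙-*-cong (step? n (x , y) (x′ , y′)) λ { ((x<x′ , _) , _ , _ , x′<n) → chains-vanish m x′<n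
      (≤-trans n≤m+x (≤-trans (≤-reflexive (sym (+-suc m x))) (+-monoʳ-≤ m x<x′))) })
    (*-zeroʳ (𝟙 (step? n (x , y) (x′ , y′))))

chainsFrom : ℕ → ℕ → ℕ → ℕ
chainsFrom n x y = ∑ n (λ m → chains n m (x , y))

chainsAbove : ℕ → ℕ → ℕ → ℕ
chainsAbove n x y = ∑ n (λ y′ → 𝟙 (y <? y′) * (𝟙 (cell? n (x , y′)) * chainsFrom n x y′))

chainsBeyond : ℕ → ℕ → ℕ → ℕ
chainsBeyond n x y = ∑ n (λ x′ → 𝟙 (x <? x′) * chainsAbove n x′ y)

chainsFrom≡1+∑step : ∀ {n x} y → x < n → chainsFrom n x y
  ≡ 1 + ∑ n (λ x′ → ∑ n (λ y′ → 𝟙 (step? n (x , y) (x′ , y′)) * chainsFrom n x′ y′))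
chainsFrom≡1+∑step {suc n′} {x} y _ = cong (1 +_) (begin
  ∑ n′ (λ m → chains n (suc m) (x , y))
    ≡⟨ ∑-cong n′ (λ m _ → chains-suc n m (x , y)) ⟩
  ∑ n′ (λ m → ∑ n (λ x′ → ∑ n (λ y′ → step x′ y′ * chains n m (x′ , y′))))
    ≡⟨ ∑-comm₃ n′ n n (λ m x′ y′ → step x′ y′ * chains n m (x′ , y′)) ⟩
  ∑ n (λ x′ → ∑ n (λ y′ → ∑ n′ (λ m → step x′ y′ * chains n m (x′ , y′))))
    ≡⟨ ∑-cong n (λ x′ _ → ∑-cong n (λ y′ _ → trans (∑-*ˡ n′ (step x′ y′) _)
         (𝟙-*-cong (step? n (x , y) (x′ , y′)) (dropLast x′ y′)))) ⟩
  ∑ n (λ x′ → ∑ n (λ y′ → step x′ y′ * chainsFrom n x′ y′)) ∎)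
  where
  open ≡-Reasoning
  n : ℕ
  n = suc n′
  step : ℕ → ℕ → ℕ
  step x′ y′ = 𝟙 (step? n (x , y) (x′ , y′))
  dropLast : ∀ x′ y′ → Step n (x , y) (x′ , y′) →
             ∑ n′ (λ m → chains n m (x′ , y′)) ≡ chainsFrom n x′ y′
  dropLast x′ y′ ((x<x′ , _) , _ , _ , x′<n) = sym (begin
    chainsFrom n x′ y′                     ≡⟨ ∑-snoc n′ (λ m → chains n m (x′ , y′)) ⟩
    shorter + chains n n′ (x′ , y′)        ≡⟨ cong (shorter +_) (chains-vanish n′ x′<n n≤n′+x′) ⟩
    shorter + 0                            ≡⟨ +-identityʳ shorter ⟩
    shorter                                ∎)
    where
    shorter : ℕ
    shorter = ∑ n′ (λ m → chains n m (x′ , y′))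
    n≤n′+x′ : n ≤ n′ + x′
    n≤n′+x′ = ≤-trans (≤-reflexive (+-comm 1 n′)) (+-monoʳ-≤ n′ (≤-<-trans z≤n x<x′))

𝟙-step : ∀ n x y x′ y′ →
  𝟙 (step? n (x , y) (x′ , y′)) ≡ 𝟙 (x <? x′) * (𝟙 (y <? y′) * 𝟙 (cell? n (x′ , y′)))
𝟙-step n x y x′ y′ = begin
  𝟙 (((x <? x′) ×-dec (y <? y′)) ×-dec cell? n (x′ , y′))
    ≡⟨ 𝟙-× ((x <? x′) ×-dec (y <? y′)) (cell? n (x′ , y′)) ⟩
  𝟙 ((x <? x′) ×-dec (y <? y′)) * 𝟙 (cell? n (x′ , y′))
    ≡⟨ cong (_* 𝟙 (cell? n (x′ , y′))) (𝟙-× (x <? x′) (y <? y′)) ⟩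
  𝟙 (x <? x′) * 𝟙 (y <? y′) * 𝟙 (cell? n (x′ , y′))
    ≡⟨ *-assoc (𝟙 (x <? x′)) _ _ ⟩
  𝟙 (x <? x′) * (𝟙 (y <? y′) * 𝟙 (cell? n (x′ , y′))) ∎
  where open ≡-Reasoning

chainsFrom≡1+chainsBeyond : ∀ {n x} y → x < n → chainsFrom n x y ≡ 1 + chainsBeyond n x y
chainsFrom≡1+chainsBeyond {n} {x} y x<n = trans (chainsFrom≡1+∑step y x<n)
  (cong (1 +_) (∑-cong n (λ x′ _ →
    trans (∑-cong n (λ y′ _ → regroup x′ y′)) (∑-*ˡ n (𝟙 (x <? x′)) _))))
  where
  regroup : ∀ x′ y′ → 𝟙 (step? n (x , y) (x′ , y′)) * chainsFrom n x′ y′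
                    ≡ 𝟙 (x <? x′) * (𝟙 (y <? y′) * (𝟙 (cell? n (x′ , y′)) * chainsFrom n x′ y′))
  regroup x′ y′ = trans (cong (_* chainsFrom n x′ y′) (𝟙-step n x y x′ y′))
    (trans (*-assoc (𝟙 (x <? x′)) _ _) (cong (𝟙 (x <? x′) *_) (*-assoc (𝟙 (y <? y′)) _ _)))

chainsFrom-last : ∀ {n x} y → suc x ≡ n → chainsFrom n x y ≡ 1
chainsFrom-last {x = x} y refl = trans (chainsFrom≡1+chainsBeyond {suc x} y ≤-refl)
  (cong suc (∑-above-empty {x} (λ x′ → chainsAbove (suc x) x′ y) ≤-refl))

chainsFrom-step : ∀ {n x} y → suc x < n →
  chainsFrom n x y ≡ chainsAbove n (suc x) y + chainsFrom n (suc x) y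
chainsFrom-step {n} {x} y 1+x<n = begin
  chainsFrom n x y               ≡⟨ chainsFrom≡1+chainsBeyond y (<-trans (n<1+n x) 1+x<n) ⟩
  1 + chainsBeyond n x y         ≡⟨ cong (1 +_) (∑-above (λ x′ → chainsAbove n x′ y) 1+x<n) ⟩
  1 + (nextColumn + farther)     ≡⟨ +-suc nextColumn farther ⟨
  nextColumn + (1 + farther)     ≡⟨ cong (nextColumn +_) (chainsFrom≡1+chainsBeyond y 1+x<n) ⟨
  nextColumn + chainsFrom n (suc x) y ∎
  where
  open ≡-Reasoning
  nextColumn farther : ℕ
  nextColumn = chainsAbove n (suc x) y
  farther    = chainsBeyond n (suc x) y

chainsAbove-top : ∀ {n x y} → x ≤ y → chainsAbove n x y ≡ 0
chainsAbove-top {n} {x} {y} x≤y = ∑-zero n (λ y′ _ → trans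
  (𝟙-*-cong (y <? y′) λ y<y′ → cong (_* chainsFrom n x y′)
    (𝟙-no (cell? n (x , y′)) λ (_ , y′≤x , _) → <⇒≱ y<y′ (≤-trans y′≤x x≤y)))
  (*-zeroʳ (𝟙 (y <? y′))))

chainsAbove-step : ∀ {n x y} → suc y ≤ x → x < n →
  chainsAbove n x y ≡ chainsFrom n x (suc y) + chainsAbove n x (suc y)
chainsAbove-step {n} {x} {y} 1+y≤x x<n =
  trans (∑-above (λ y′ → 𝟙 (cell? n (x , y′)) * chainsFrom n x y′) (≤-<-trans 1+y≤x x<n))
        (cong (_+ chainsAbove n x (suc y))
              (trans (cong (_* chainsFrom n x (suc y)) (𝟙-yes (cell? n (x , suc y)) (z<s , 1+y≤x , x<n)))
                     (*-identityˡ _)))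

mutual
  chainsFrom-ballot : ∀ {n} r d y → suc (y + d + r) ≡ n → chainsFrom n (y + d) y ≡ ballot r d
  chainsFrom-ballot zero d y 1+y+d≡n =
    chainsFrom-last y (trans (cong suc (sym (+-identityʳ (y + d)))) 1+y+d≡n)
  chainsFrom-ballot {n} (suc r) d y 1+y+d+r≡n = begin
    chainsFrom n (y + d) y
      ≡⟨ chainsFrom-step y (≤-trans (s≤s (m<m+n (y + d) z<s)) (≤-reflexive 1+y+d+r≡n)) ⟩
    chainsAbove n (suc (y + d)) y + chainsFrom n (suc (y + d)) y
      ≡⟨ cong (λ x → chainsAbove n x y + chainsFrom n x y) (+-suc y d) ⟨
    chainsAbove n (y + suc d) y + chainsFrom n (y + suc d) y
      ≡⟨ cong₂ _+_ (chainsAbove-ballot r (suc d) y shifted) (chainsFrom-ballot r (suc d) y shifted) ⟩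
    ∑ (suc d) (ballot r) + ballot r (suc d)
      ≡⟨ ∑-snoc (suc d) (ballot r) ⟨
    ballot (suc r) d ∎
    where
    open ≡-Reasoning
    shift : ∀ y d r → y + suc d + r ≡ y + d + suc r
    shift = solve-∀
    shifted : suc (y + suc d + r) ≡ n
    shifted = trans (cong suc (shift y d r)) 1+y+d+r≡n

  chainsAbove-ballot : ∀ {n} r d y → suc (y + d + r) ≡ n → chainsAbove n (y + d) y ≡ ∑ d (ballot r)
  chainsAbove-ballot {n} r zero y _ = chainsAbove-top {n} (≤-reflexive (+-identityʳ y))
  chainsAbove-ballot {n} r (suc d) y 1+y+d+r≡n = begin
    chainsAbove n (y + suc d) y
      ≡⟨ chainsAbove-step (≤-trans (s≤s (m≤m+n y d)) (≤-reflexive (sym (+-suc y d))))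
                          (≤-trans (s≤s (m≤m+n _ r)) (≤-reflexive 1+y+d+r≡n)) ⟩
    chainsFrom n (y + suc d) (suc y) + chainsAbove n (y + suc d) (suc y)
      ≡⟨ cong (λ x → chainsFrom n x (suc y) + chainsAbove n x (suc y)) (+-suc y d) ⟩
    chainsFrom n (suc y + d) (suc y) + chainsAbove n (suc y + d) (suc y)
      ≡⟨ cong₂ _+_ (chainsFrom-ballot r d (suc y) shifted) (chainsAbove-ballot r d (suc y) shifted) ⟩
    ballot r d + ∑ d (ballot r)
      ≡⟨ +-comm (ballot r d) _ ⟩
    ∑ d (ballot r) + ballot r d
      ≡⟨ ∑-snoc d (ballot r) ⟨
    ∑ (suc d) (ballot r) ∎
    where
    open ≡-Reasoning
    shifted : suc (suc y + d + r) ≡ n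
    shifted = trans (cong (λ x → suc (x + r)) (sym (+-suc y d))) 1+y+d+r≡n

θ≡chainsAbove : ∀ {n k} → k < n → θ n k ≡ chainsAbove n k 0
θ≡chainsAbove {n} {k} k<n = begin
  θ n k
    ≡⟨ θ≡∑chains n k ⟩
  ∑ n (λ m → ∑ n (λ x → ∑ n (λ y → start x y * chains n m (x , y))))
    ≡⟨ ∑-comm₃ n n n (λ m x y → start x y * chains n m (x , y)) ⟩
  ∑ n (λ x → ∑ n (λ y → ∑ n (λ m → start x y * chains n m (x , y))))
    ≡⟨ ∑-cong n (λ x _ → trans (∑-cong n (λ y _ → trans (∑-*ˡ n (start x y) _) (regroup x y)))
                               (∑-*ˡ n (𝟙 (x ≟ k)) _)) ⟩
  ∑ n (λ x → 𝟙 (x ≟ k) * ∑ n (λ y → 𝟙 (cell? n (x , y)) * chainsFrom n x y))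
    ≡⟨ ∑-δ (λ x → ∑ n (λ y → 𝟙 (cell? n (x , y)) * chainsFrom n x y)) k<n ⟩
  ∑ n (λ y → 𝟙 (cell? n (k , y)) * chainsFrom n k y)
    ≡⟨ ∑-cong n (λ y _ → redundantPositivity y) ⟩
  chainsAbove n k 0 ∎
  where
  open ≡-Reasoning
  start : ℕ → ℕ → ℕ
  start x y = 𝟙 (start? n k (x , y))
  regroup : ∀ x y → start x y * chainsFrom n x y
                  ≡ 𝟙 (x ≟ k) * (𝟙 (cell? n (x , y)) * chainsFrom n x y)
  regroup x y = trans (cong (_* chainsFrom n x y) (𝟙-× (x ≟ k) (cell? n (x , y))))
                      (*-assoc (𝟙 (x ≟ k)) _ _)
  redundantPositivity : ∀ y → 𝟙 (cell? n (k , y)) * chainsFrom n k y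
                            ≡ 𝟙 (0 <? y) * (𝟙 (cell? n (k , y)) * chainsFrom n k y)
  redundantPositivity zero    = refl
  redundantPositivity (suc y) = sym (+-identityʳ _)

θ-ballot : ∀ {n k} → k < n → θ n k ≡ ∑ k (ballot (n ∸ suc k))
θ-ballot {n} {k} k<n =
  trans (θ≡chainsAbove k<n) (chainsAbove-ballot (n ∸ suc k) k 0 (m+[n∸m]≡n k<n))

θ-recurrence : ∀ {n k} → suc k < n → θ (suc n) (suc k) ≡ θ n k + θ (suc n) (suc (suc k))
θ-recurrence {n} {k} 1+k<n = begin
  θ (suc n) (suc k)                        ≡⟨ θ-ballot (s<s k<n) ⟩
  ∑ (suc k) (ballot (n ∸ suc k))           ≡⟨ cong (λ r → ∑ (suc k) (ballot r)) gap ⟩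
  ∑ (suc k) (ballot (suc r))               ≡⟨ ∑-snoc k (ballot (suc r)) ⟩
  ∑ k (ballot (suc r)) + ballot (suc r) k  ≡⟨ cong₂ _+_ θ-left (θ-ballot (s<s 1+k<n)) ⟨
  θ n k + θ (suc n) (suc (suc k))          ∎
  where
  open ≡-Reasoning
  k<n : k < n
  k<n = <-trans (n<1+n k) 1+k<n
  r : ℕ
  r = n ∸ suc (suc k)
  gap : n ∸ suc k ≡ suc r
  gap = +-∸-assoc 1 1+k<n
  θ-left : θ n k ≡ ∑ k (ballot (suc r))
  θ-left = trans (θ-ballot k<n) (cong (λ r → ∑ k (ballot r)) gap)

lemma5p2 : (n : ℕ) → n ≥ 2 →
    (θ n 1 ≡ catalan (n ∸ 1))
    × (θ n (n ∸ 1) ≡ n ∸ 1)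
    × (n > 2 → (k : ℕ) → 2 ≤ k → k ≤ n ∸ 2 →
        θ n k ≡ θ (n ∸ 1) (k ∸ 1) + θ n (suc k))
lemma5p2 (suc zero) (s≤s ())
lemma5p2 (suc (suc n)) _ = first-column , last-column , recurrence
  where
  first-column : θ (2 + n) 1 ≡ catalan (suc n)
  first-column =
    trans (θ-ballot {2 + n} {1} (s<s z<s)) (trans (+-identityʳ (ballot n 0)) (ballot-catalan n))
  last-column : θ (2 + n) (suc n) ≡ suc n
  last-column = trans (θ-ballot {2 + n} {suc n} ≤-refl)
    (trans (cong (λ r → ∑ (suc n) (ballot r)) (n∸n≡0 n)) (∑-const-1 (suc n)))
  recurrence : 2 + n > 2 → (k : ℕ) → 2 ≤ k → k ≤ n →
    θ (2 + n) k ≡ θ (suc n) (k ∸ 1) + θ (2 + n) (suc k)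
  recurrence _ (suc k) _ 1+k≤n = θ-recurrence (s<s 1+k≤n)
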